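{- Let $G_i$ be a finite graph with node set $V_i$, let $g\ge1$ be an integer, and let $N^1,\dots,N^h$ be pairwise disjoint connected dominating sets of $G_i$ whose union is $V_i$. Assign the nodes of $V_i$ to groups by the group procedure described in the context, producing $M=\lfloor |V_i|/g\rfloor$ full groups. Then the minimum number of these full groups that must be removed so that every $N^l$ ($l=1,\dots,h$) contains at least one removed node is at least $\min(\lceil (h-1)/2\rceil,\ \lfloor |V_i|/g\rfloor)$.
   Context: A connected dominating set (CDS) of a graph is a node set $S$ such that the induced subgraph on $S$ is connected and every node is in $S$ or adjacent to a node of $S$. Group procedure: index the CDS so that $|N^1|\le|N^2|\le\dots\le|N^h|$. There are $M=\lfloor |V_i|/g\rfloor$ groups of capacity $g$, initially empty; a group is empty if it has no node, full if it has $g$ nodes, and occupied otherwise. For $l=1,\dots,h$ in turn, the nodes of $N^l$ are placed: while nodes of $N^l$ remain and an empty group exists, an empty group is taken and filled with up to $g$ remaining nodes of $N^l$; if nodes of $N^l$ remain and no empty group exists, the remaining nodes are placed into occupied groups until these become full. The procedure terminates when all $M$ groups are full; any remaining (fewer than $g$) nodes form an extra leftover group, which is not among the $M$ full groups. Removing a group means removing all of its nodes. -}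

module Defs where

open import Data.Nat using (ℕ; _<_; _≤_)
open import Data.Fin using (Fin; _≟_)
open import Data.List using (List; []; _∷_; _++_; [_]; take; drop; length; tabulate)
open import Data.List.Membership.Propositional using (_∈_)
open import Data.Product using (_×_; _,_; ∃)
open import Data.Sum using (_⊎_)
open import Data.Empty using (⊥)
open import Relation.Nullary using (¬_; yes; no)
open import Relation.Binary.PropositionalEquality using (_≡_; _≢_)
open import Relation.Binary.Construct.Closure.ReflexiveTransitive using (Star)

record Graph (n : ℕ) : Set₁ where
  field
    Adj   : Fin n → Fin n → Set
    sym   : ∀ {x y} → Adj x y → Adj y x
    irrefl : ∀ {x} → ¬ Adj x x
open Graph public

-- Walks whose every node lies in S (the start x is assumed in S by the caller).
data WalkIn {n : ℕ} (G : Graph n) (S : Fin n → Set) : Fin n → Fin n → Set where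
  here : ∀ {x} → WalkIn G S x x
  step : ∀ {x y z} → Adj G x y → S y → WalkIn G S y z → WalkIn G S x z

InducedConnected : ∀ {n} → Graph n → (Fin n → Set) → Set
InducedConnected G S = ∀ x y → S x → S y → WalkIn G S x y

Dominating : ∀ {n} → Graph n → (Fin n → Set) → Set
Dominating G S = ∀ x → S x ⊎ ∃ λ y → S y × Adj G x y

IsCDS : ∀ {n} → Graph n → (Fin n → Set) → Set
IsCDS G S = InducedConnected G S × Dominating G S

-- The group procedure, as a (nondeterministic) transition system.
-- State: contents of the M groups, and the list of node lists still to
-- be placed (head = remaining nodes of the current N^l).

Groups : ℕ → ℕ → Set
Groups n M = Fin M → List (Fin n)

update : ∀ {n M} → Groups n M → Fin M → List (Fin n) → Groups n M
update Gr j xs k with k ≟ j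
... | yes _ = xs
... | no  _ = Gr k

State : ℕ → ℕ → Set
State n M = Groups n M × List (List (Fin n))

data Step {n : ℕ} (g M : ℕ) : State n M → State n M → Set where
  fill : ∀ {Gr x xs rest} (j : Fin M) → Gr j ≡ [] →
         Step g M (Gr , (x ∷ xs) ∷ rest)
                  (update Gr j (take g (x ∷ xs)) , drop g (x ∷ xs) ∷ rest)
  top  : ∀ {Gr x xs rest} (j : Fin M) → (∀ k → Gr k ≢ []) →
         Gr j ≢ [] → length (Gr j) < g →
         Step g M (Gr , (x ∷ xs) ∷ rest)
                  (update Gr j (Gr j ++ [ x ]) , xs ∷ rest)
  next : ∀ {Gr rest} → Step g M (Gr , [] ∷ rest) (Gr , rest)

emptyGroups : ∀ {n M} → Groups n M
emptyGroups _ = []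

AllFull : ∀ {n M} → ℕ → Groups n M → Set
AllFull g Gr = ∀ j → length (Gr j) ≡ g

-- Gr is a possible result of running the group procedure with group size g
-- and M groups on the node lists N 0, ..., N (h-1) (in this order): it is
-- reachable from the all-empty configuration and all M groups are full
-- (the procedure stops at that moment; leftover nodes are not in Gr).
GroupOutcome : ∀ {n h} (g M : ℕ) → (Fin h → List (Fin n)) → Groups n M → Set
GroupOutcome {n} {h} g M N Gr =
  ∃ λ rest → Star (Step {n} g M) (emptyGroups , tabulate N) (Gr , rest)
             × AllFull {n} {M} g Gr

module Submission where

-- While empty groups exist, each set N^l opens groups for itself (fill
-- steps), and the set opening a group is its owner.  Let s be the set at
-- which a node is first appended to an occupied group (top-up step); every
-- node of group j then lies in N^(owner j) or in a set of index ≥ s, so the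
-- removed groups hitting N^0, ..., N^(s-1) have distinct owners: s ≤ |R|.
-- Moreover s ≥ min(⌈(h-1)/2⌉, M): either the M groups were opened by sets
-- of size ≤ g, one group each, so M ≤ s; or N^s and (by sortedness) all
-- later sets have more than g nodes, while at most (g-1)·s slots were free
-- at set s, so fewer than s further sets fit and h - 1 ≤ 2s.

open import Defs
open import Data.Nat using (ℕ; _≤_; _/_; _∸_; ⌈_/2⌉; _⊓_; NonZero)
open import Data.Fin using (Fin; toℕ)
open import Data.Fin.Subset using (Subset; _∈_; ∣_∣)
open import Data.Empty renaming (⊥ to Empty)
open import Data.List using (List; length)
open import Data.List.Membership.Propositional renaming (_∈_ to _∈ₗ_)
open import Data.List.Relation.Unary.Unique.Propositional using (Unique)
open import Data.Product using (_×_; ∃)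
open import Relation.Binary.PropositionalEquality using (_≢_)

open import Data.Empty using (⊥-elim)
open import Data.Fin using (zero; suc; fromℕ<; punchIn) renaming (_≟_ to _≟ᶠ_)
open import Data.Fin.Properties using (toℕ-fromℕ<; punchInᵢ≢i)
open import Data.Fin.Subset using (_-_)
open import Data.Fin.Subset.Properties using (x∈p⇒∣p-x∣<∣p∣; x∈p∧x≢y⇒x∈p-y)
open import Data.List using ([]; _∷_; _++_; [_]; take; drop; tabulate)
open import Data.List.Membership.Propositional.Properties using (∈-++⁻; ∈-++⁺ˡ; ∈-++⁺ʳ)
open import Data.List.Properties
  using (length-++; length-take; length-tabulate; take++drop≡id; ++-assoc; ++-identityʳ; drop-all)
open import Data.List.Relation.Unary.Any using (here)
open import Data.Nat using (zero; suc; _+_; _*_; _<_; z≤n; s≤s; z<s; _<?_)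
open import Data.Nat.Properties
open import Data.Nat.Tactic.RingSolver using (solve-∀)
open import Algebra.Properties.CommutativeMonoid.Sum +-0-commutativeMonoid
  using (sum; sum-cong-≗; sum-remove; sum-replicate-zero)
open import Data.Product using (Σ; _,_; proj₁; proj₂)
open import Data.Sum using (_⊎_; inj₁; inj₂; map₂; [_,_]′)
open import Data.Vec.Functional using (removeAt; updateAt)
open import Data.Vec.Functional.Properties using (updateAt-updates; updateAt-minimal)
open import Function using (_∘_; const)
open import Relation.Nullary using (yes; no)
open import Relation.Binary.PropositionalEquality
  using (_≡_; refl; trans; cong; cong₂; subst; subst₂; module ≡-Reasoning)
  renaming (sym to ≡-sym)
open import Relation.Binary.Construct.Closure.ReflexiveTransitive using (Star; ε; _◅_)

owners-cover⇒≤∣R∣ : ∀ {M} (owner : Fin M → ℕ) s (R : Subset M) →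
                    (∀ k → k < s → ∃ λ j → j ∈ R × owner j ≡ k) → s ≤ ∣ R ∣
owners-cover⇒≤∣R∣ owner zero R cover = z≤n
owners-cover⇒≤∣R∣ owner (suc s) R cover with cover s ≤-refl
... | j , j∈R , owner-j≡s =
  ≤-trans (s≤s (owners-cover⇒≤∣R∣ owner s (R - j) cover′)) (x∈p⇒∣p-x∣<∣p∣ j∈R)
  where
  cover′ : ∀ k → k < s → ∃ λ i → i ∈ R - j × owner i ≡ k
  cover′ k k<s with cover k (m<n⇒m<1+n k<s)
  ... | i , i∈R , owner-i≡k = i , x∈p∧x≢y⇒x∈p-y i∈R i≢j , owner-i≡k
    where
    i≢j : i ≢ j
    i≢j refl = <⇒≢ k<s (trans (≡-sym owner-i≡k) owner-j≡s)

⌈/2⌉≤ : ∀ {a s} → a ≤ s + s → ⌈ a /2⌉ ≤ s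
⌈/2⌉≤ {a} {s} a≤2s = subst (⌈ a /2⌉ ≤_) (≡-sym (n≡⌈n+n/2⌉ s)) (⌈n/2⌉-mono a≤2s)

pred-< : ∀ {m k} → m < k → k ∸ 1 < k
pred-< {k = suc k} _ = ≤-refl

sum-update : ∀ {M} (f f′ : Fin M → ℕ) j → (∀ k → k ≢ j → f′ k ≡ f k) →
             sum f′ + f j ≡ sum f + f′ j
sum-update {suc M} f f′ j same = begin
  sum f′ + f j                      ≡⟨ cong (_+ f j) (sum-remove {i = j} f′) ⟩
  f′ j + sum (removeAt f′ j) + f j  ≡⟨ cong (λ r → f′ j + r + f j) rest ⟩
  f′ j + sum (removeAt f j) + f j   ≡⟨ swap (f′ j) (sum (removeAt f j)) (f j) ⟩
  f j + sum (removeAt f j) + f′ j   ≡⟨ cong (_+ f′ j) (≡-sym (sum-remove {i = j} f)) ⟩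
  sum f + f′ j                      ∎
  where
  open ≡-Reasoning
  rest : sum (removeAt f′ j) ≡ sum (removeAt f j)
  rest = sum-cong-≗ (λ k → same (punchIn j k) (punchInᵢ≢i j k))
  swap : ∀ a r b → a + r + b ≡ b + r + a
  swap = solve-∀

sum-ones : ∀ {M} (f : Fin M → ℕ) → (∀ k → f k ≡ 1) → sum f ≡ M
sum-ones {zero} f ones = refl
sum-ones {suc M} f ones = cong₂ _+_ (ones zero) (sum-ones (f ∘ suc) (ones ∘ suc))

sum-zeros : ∀ {M} (f : Fin M → ℕ) → (∀ k → f k ≡ 0) → sum f ≡ 0
sum-zeros {M} f zeros = trans (sum-cong-≗ zeros) (sum-replicate-zero M)

drop-tabulate : ∀ {A : Set} {h} (N : Fin h → A) i (i<h : i < h) →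
                drop i (tabulate N) ≡ N (fromℕ< i<h) ∷ drop (suc i) (tabulate N)
drop-tabulate {h = suc h} N zero    i<h       = refl
drop-tabulate {h = suc h} N (suc i) (s≤s i<h) = drop-tabulate (N ∘ suc) i i<h

drop-tabulate-≥ : ∀ {A : Set} {h} (N : Fin h → A) i → h ≤ i → drop i (tabulate N) ≡ []
drop-tabulate-≥ N i h≤i = drop-all i (tabulate N) (subst (_≤ i) (≡-sym (length-tabulate N)) h≤i)

drop-nonempty⇒< : ∀ {A : Set} k (xs : List A) → drop k xs ≢ [] → k < length xs
drop-nonempty⇒< zero    []       nonempty = ⊥-elim (nonempty refl)
drop-nonempty⇒< zero    (x ∷ xs) nonempty = z<s
drop-nonempty⇒< (suc k) []       nonempty = ⊥-elim (nonempty refl)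
drop-nonempty⇒< (suc k) (x ∷ xs) nonempty = s≤s (drop-nonempty⇒< k xs nonempty)

∈-split : ∀ {A : Set} {pre xs ys : List A} {x} → pre ++ x ∷ xs ≡ ys → x ∈ₗ ys
∈-split {pre = pre} {x = x} split = subst (x ∈ₗ_) split (∈-++⁺ʳ pre (here refl))

update-same : ∀ {n M} (Gr : Groups n M) j xs → update Gr j xs j ≡ xs
update-same Gr j xs with j ≟ᶠ j
... | yes _  = refl
... | no j≢j = ⊥-elim (j≢j refl)

update-other : ∀ {n M} (Gr : Groups n M) j xs k → k ≢ j → update Gr j xs k ≡ Gr k
update-other Gr j xs k k≢j with k ≟ᶠ j
... | yes k≡j = ⊥-elim (k≢j k≡j)
... | no _    = refl

∈-update : ∀ {n M} (Gr : Groups n M) j xs k {x} → x ∈ₗ update Gr j xs k →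
           (k ≡ j × x ∈ₗ xs) ⊎ (k ≢ j × x ∈ₗ Gr k)
∈-update Gr j xs k x∈ with k ≟ᶠ j
... | yes k≡j = inj₁ (k≡j , x∈)
... | no k≢j  = inj₂ (k≢j , x∈)

append-occupied : ∀ {n M} (Gr : Groups n M) j x → (∀ k → Gr k ≢ []) →
                  ∀ k → update Gr j (Gr j ++ [ x ]) k ≢ []
append-occupied Gr j x occupied k with k ≟ᶠ j | Gr j | occupied j
... | yes _ | []    | Grj≢[] = λ _ → Grj≢[] refl
... | yes _ | _ ∷ _ | _      = λ ()
... | no _  | _     | _      = occupied k

module GroupProcedure {n : ℕ} (g′ h : ℕ) (N : Fin h → List (Fin n))
  (sorted : ∀ l l′ → toℕ l ≤ toℕ l′ → length (N l) ≤ length (N l′))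
  (M : ℕ) where

  g : ℕ
  g = suc g′

  set : (l : ℕ) → l < h → List (Fin n)
  set l l<h = N (fromℕ< l<h)

  set-sorted : ∀ {a b} (a<h : a < h) (b<h : b < h) → a ≤ b →
               length (set a a<h) ≤ length (set b b<h)
  set-sorted a<h b<h a≤b =
    sorted _ _ (subst₂ _≤_ (≡-sym (toℕ-fromℕ< a<h)) (≡-sym (toℕ-fromℕ< b<h)) a≤b)

  Large : (l : ℕ) → l < h → Set
  Large l l<h = g < length (set l l<h)

  slack : List (Fin n) → ℕ
  slack []       = 0
  slack (_ ∷ xs) = g′ ∸ length xs

  occupied : List (Fin n) → ℕ
  occupied []      = 0
  occupied (_ ∷ _) = 1

  Slack Occupied : Groups n M → ℕ
  Slack Gr    = sum (slack ∘ Gr)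
  Occupied Gr = sum (occupied ∘ Gr)

  total-fill : (μ : List (Fin n) → ℕ) → μ [] ≡ 0 → ∀ (Gr : Groups n M) j ch →
               Gr j ≡ [] → sum (μ ∘ update Gr j ch) ≡ sum (μ ∘ Gr) + μ ch
  total-fill μ μ[]≡0 Gr j ch empty = begin
    sum (μ ∘ update Gr j ch)            ≡⟨ ≡-sym (+-identityʳ _) ⟩
    sum (μ ∘ update Gr j ch) + 0        ≡⟨ cong (sum (μ ∘ update Gr j ch) +_) μGrj≡0 ⟩
    sum (μ ∘ update Gr j ch) + μ (Gr j) ≡⟨ sum-update (μ ∘ Gr) (μ ∘ update Gr j ch) j unchanged ⟩
    sum (μ ∘ Gr) + μ (update Gr j ch j) ≡⟨ cong (λ zs → sum (μ ∘ Gr) + μ zs) (update-same Gr j ch) ⟩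
    sum (μ ∘ Gr) + μ ch                 ∎
    where
    open ≡-Reasoning
    μGrj≡0 : 0 ≡ μ (Gr j)
    μGrj≡0 = ≡-sym (trans (cong μ empty) μ[]≡0)
    unchanged : ∀ k → k ≢ j → μ (update Gr j ch k) ≡ μ (Gr k)
    unchanged k k≢j = cong μ (update-other Gr j ch k k≢j)

  slack-append : ∀ zs x → zs ≢ [] → length zs < g → slack zs ≡ suc (slack (zs ++ [ x ]))
  slack-append []       x nonempty _         = ⊥-elim (nonempty refl)
  slack-append (_ ∷ zs) x _        (s≤s zs<g′) = begin
    g′ ∸ length zs                  ≡⟨ +-∸-assoc 1 zs<g′ ⟩
    suc (g′ ∸ suc (length zs))      ≡⟨ cong (λ m → suc (g′ ∸ m)) (+-comm 1 (length zs)) ⟩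
    suc (g′ ∸ (length zs + 1))      ≡⟨ cong (λ m → suc (g′ ∸ m)) (≡-sym (length-++ zs)) ⟩
    suc (g′ ∸ length (zs ++ [ x ])) ∎
    where open ≡-Reasoning

  slack-top : ∀ (Gr : Groups n M) j x → Gr j ≢ [] → length (Gr j) < g →
              suc (Slack (update Gr j (Gr j ++ [ x ]))) ≡ Slack Gr
  slack-top Gr j x nonempty room = +-cancelʳ-≡ _ _ _ (begin
    suc (Slack Gr′) + slack (Gr j ++ [ x ]) ≡⟨ ≡-sym (+-suc _ _) ⟩
    Slack Gr′ + suc (slack (Gr j ++ [ x ])) ≡⟨ cong (Slack Gr′ +_) (≡-sym (slack-append (Gr j) x nonempty room)) ⟩
    Slack Gr′ + slack (Gr j)                ≡⟨ sum-update (slack ∘ Gr) (slack ∘ Gr′) j unchanged ⟩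
    Slack Gr + slack (Gr′ j)                ≡⟨ cong (λ zs → Slack Gr + slack zs) (update-same Gr j _) ⟩
    Slack Gr + slack (Gr j ++ [ x ])        ∎)
    where
    open ≡-Reasoning
    Gr′ : Groups n M
    Gr′ = update Gr j (Gr j ++ [ x ])
    unchanged : ∀ k → k ≢ j → slack (Gr′ k) ≡ slack (Gr k)
    unchanged k k≢j = cong slack (update-other Gr j _ k k≢j)

  all-occupied⇒Occupied≡M : ∀ (Gr : Groups n M) → (∀ j → Gr j ≢ []) → Occupied Gr ≡ M
  all-occupied⇒Occupied≡M Gr occ = sum-ones (occupied ∘ Gr) one
    where
    one : ∀ j → occupied (Gr j) ≡ 1
    one j with Gr j | occ j
    ... | []    | Grj≢[] = ⊥-elim (Grj≢[] refl)
    ... | _ ∷ _ | _      = refl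

  all-full⇒Slack≡0 : ∀ (Gr : Groups n M) → AllFull g Gr → Slack Gr ≡ 0
  all-full⇒Slack≡0 Gr full = sum-zeros (slack ∘ Gr) none
    where
    none : ∀ j → slack (Gr j) ≡ 0
    none j with Gr j | full j
    ... | _ ∷ zs | refl = n∸n≡0 (length zs)

  Provenance : Groups n M → ℕ → (Fin M → ℕ) → ℕ → Set
  Provenance Gr l owner s = ∀ j x → x ∈ₗ Gr j →
    ∃ λ k → x ∈ₗ N k × toℕ k ≤ l × (toℕ k ≡ owner j ⊎ s ≤ toℕ k)

  provenance-lower : ∀ {Gr l o s s′} → s′ ≤ s → Provenance Gr l o s → Provenance Gr l o s′
  provenance-lower s′≤s prov j x x∈ with prov j x x∈
  ... | k , x∈k , k≤l , inj₁ owned = k , x∈k , k≤l , inj₁ owned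
  ... | k , x∈k , k≤l , inj₂ late  = k , x∈k , k≤l , inj₂ (≤-trans s′≤s late)

  provenance-next : ∀ {Gr l o s} → Provenance Gr l o s → Provenance Gr (suc l) o s
  provenance-next prov j x x∈ with prov j x x∈
  ... | k , x∈k , k≤l , origin = k , x∈k , m≤n⇒m≤1+n k≤l , origin

  provenance-fill : ∀ {Gr l o s} (l<h : l < h) j ch → (∀ {x} → x ∈ₗ ch → x ∈ₗ set l l<h) →
                    Provenance Gr l o s → Provenance (update Gr j ch) l (updateAt o j (const l)) s
  provenance-fill {Gr} {l} {o} l<h j ch ch⊆l prov k x x∈ with ∈-update Gr j ch k x∈
  ... | inj₁ (refl , x∈ch) =
    fromℕ< l<h , ch⊆l x∈ch , ≤-reflexive (toℕ-fromℕ< l<h) ,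
    inj₁ (trans (toℕ-fromℕ< l<h) (≡-sym (updateAt-updates k o)))
  ... | inj₂ (k≢j , x∈old) with prov k x x∈old
  ...   | k′ , x∈k′ , k′≤l , inj₁ owned =
          k′ , x∈k′ , k′≤l , inj₁ (trans owned (≡-sym (updateAt-minimal k j o k≢j)))
  ...   | k′ , x∈k′ , k′≤l , inj₂ late = k′ , x∈k′ , k′≤l , inj₂ late

  provenance-top : ∀ {Gr l o s s′} (l<h : l < h) j x → x ∈ₗ set l l<h → s′ ≤ s → s′ ≤ l →
                   Provenance Gr l o s → Provenance (update Gr j (Gr j ++ [ x ])) l o s′
  provenance-top {Gr} {l} {s′ = s′} l<h j x x∈l s′≤s s′≤l prov k y y∈ with ∈-update Gr j _ k y∈
  ... | inj₂ (_ , y∈old) = provenance-lower s′≤s prov k y y∈old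
  ... | inj₁ (refl , y∈new) with ∈-++⁻ (Gr k) y∈new
  ...   | inj₁ y∈old      = provenance-lower s′≤s prov k y y∈old
  ...   | inj₂ (here refl) = fromℕ< l<h , x∈l , ≤-reflexive (toℕ-fromℕ< l<h) ,
                             inj₂ (subst (s′ ≤_) (≡-sym (toℕ-fromℕ< l<h)) s′≤l)

  -- While all sets so far are small, each set opens at most one group.
  data OneGroupPerSet (Gr : Groups n M) (l : ℕ) (l<h : l < h) (cur pre : List (Fin n)) : Set where
    set-unstarted : pre ≡ [] → Occupied Gr ≤ l → OneGroupPerSet Gr l l<h cur pre
    set-done      : cur ≡ [] → Occupied Gr ≤ suc l → OneGroupPerSet Gr l l<h cur pre
    set-large     : Large l l<h → OneGroupPerSet Gr l l<h cur pre

  -- Before the first top-up step: each set leaves at most g - 1 free slots,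
  -- all in the last group it opens.
  record FillPhase (Gr : Groups n M) (l : ℕ) (l<h : l < h) (cur pre : List (Fin n)) : Set where
    constructor fill-phase
    field
      slack-before : cur ≢ [] → Slack Gr ≤ g′ * l
      slack-after  : Slack Gr ≤ g′ * suc l
      groups-used  : OneGroupPerSet Gr l l<h cur pre

  -- Free-space accounting once top-ups started at set s: at most g′·s slots
  -- were free then; since then one slot was used at set s, more than g for
  -- each of the m finished later sets, and |pre| at the current set.
  data Budget (Gr : Groups n M) (pre : List (Fin n)) (s : ℕ) : ℕ → Set where
    budget-start : suc (Slack Gr) ≤ g′ * s → Budget Gr pre s s
    budget-later : ∀ m → suc (Slack Gr + m * suc g + length pre) ≤ g′ * s →
                   Budget Gr pre s (suc (m + s))

  record TopPhase (Gr : Groups n M) (l : ℕ) (pre : List (Fin n)) (s : ℕ) : Set where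
    constructor top-phase
    field
      s≤l          : s ≤ l
      all-occupied : ∀ j → Gr j ≢ []
      small-or-budget : M ≤ s ⊎ Σ (s < h) λ s<h → Large s s<h × Budget Gr pre s l

  slack-chunk-full : ∀ x xs → drop g′ xs ≢ [] → slack (x ∷ take g′ xs) ≡ 0
  slack-chunk-full x xs rest = begin
    g′ ∸ length (take g′ xs)   ≡⟨ cong (g′ ∸_) (length-take g′ xs) ⟩
    g′ ∸ (g′ ⊓ length xs)      ≡⟨ cong (g′ ∸_) (m≤n⇒m⊓n≡m (<⇒≤ (drop-nonempty⇒< g′ xs rest))) ⟩
    g′ ∸ g′                    ≡⟨ n∸n≡0 g′ ⟩
    0                          ∎
    where open ≡-Reasoning

  fillPhase-fill : ∀ {Gr j l l<h x xs pre} → Gr j ≡ [] → pre ++ x ∷ xs ≡ set l l<h →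
                   FillPhase Gr l l<h (x ∷ xs) pre →
                   FillPhase (update Gr j (x ∷ take g′ xs)) l l<h (drop g′ xs) (pre ++ x ∷ take g′ xs)
  fillPhase-fill {Gr} {j} {l} {l<h} {x} {xs} {pre} empty split (fill-phase before _ used) =
    fill-phase before′ after′ (used′ used)
    where
    open ≤-Reasoning
    chunk : List (Fin n)
    chunk = x ∷ take g′ xs
    Gr′ : Groups n M
    Gr′ = update Gr j chunk
    slack′ : Slack Gr′ ≡ Slack Gr + slack chunk
    slack′ = total-fill slack refl Gr j chunk empty
    before′ : drop g′ xs ≢ [] → Slack Gr′ ≤ g′ * l
    before′ rest = begin
      Slack Gr′               ≡⟨ slack′ ⟩
      Slack Gr + slack chunk  ≡⟨ cong (Slack Gr +_) (slack-chunk-full x xs rest) ⟩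
      Slack Gr + 0            ≡⟨ +-identityʳ _ ⟩
      Slack Gr                ≤⟨ before (λ ()) ⟩
      g′ * l                  ∎
    after′ : Slack Gr′ ≤ g′ * suc l
    after′ = begin
      Slack Gr′               ≡⟨ slack′ ⟩
      Slack Gr + slack chunk  ≤⟨ +-mono-≤ (before (λ ())) (m∸n≤m g′ (length (take g′ xs))) ⟩
      g′ * l + g′             ≡⟨ +-comm (g′ * l) g′ ⟩
      g′ + g′ * l             ≡⟨ ≡-sym (*-suc g′ l) ⟩
      g′ * suc l              ∎
    occupied′ : Occupied Gr′ ≡ suc (Occupied Gr)
    occupied′ = trans (total-fill occupied refl Gr j chunk empty) (+-comm _ 1)
    -- the first fill step of a set either places all of it, or the set is large
    used′ : OneGroupPerSet Gr l l<h (x ∷ xs) pre →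
            OneGroupPerSet Gr′ l l<h (drop g′ xs) (pre ++ chunk)
    used′ (set-unstarted pre≡[] occ≤l) with drop g′ xs in rest
    ... | []    = set-done refl (subst (_≤ suc l) (≡-sym occupied′) (s≤s occ≤l))
    ... | _ ∷ _ = set-large (subst (λ zs → g < length zs) whole (s≤s (drop-nonempty⇒< g′ xs nonempty)))
      where
      whole : x ∷ xs ≡ set l l<h
      whole = trans (cong (_++ x ∷ xs) (≡-sym pre≡[])) split
      nonempty : drop g′ xs ≢ []
      nonempty rest≡[] with trans (≡-sym rest) rest≡[]
      ... | ()
    used′ (set-done () _)
    used′ (set-large large) = set-large large

  fillPhase-top : ∀ {Gr j l l<h x xs pre} → (∀ k → Gr k ≢ []) → Gr j ≢ [] → length (Gr j) < g →
                  FillPhase Gr l l<h (x ∷ xs) pre → TopPhase (update Gr j (Gr j ++ [ x ])) l (pre ++ [ x ]) l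
  fillPhase-top {Gr} {j} {l} {l<h} {x} {xs} {pre} occ nonempty room (fill-phase before _ used) =
    top-phase ≤-refl (append-occupied Gr j x occ) (small-or-large used)
    where
    small-or-large : OneGroupPerSet Gr l l<h (x ∷ xs) pre →
                     M ≤ l ⊎ Σ (l < h) λ l<h′ → Large l l<h′ × Budget (update Gr j (Gr j ++ [ x ])) (pre ++ [ x ]) l l
    small-or-large (set-unstarted _ occ≤l) = inj₁ (subst (_≤ l) (all-occupied⇒Occupied≡M Gr occ) occ≤l)
    small-or-large (set-done () _)
    small-or-large (set-large large) =
      inj₂ (l<h , large , budget-start (subst (_≤ g′ * l) (≡-sym (slack-top Gr j x nonempty room)) (before (λ ()))))

  budget-top : ∀ {Gr Gr′ pre x s l} → Slack Gr ≡ suc (Slack Gr′) →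
               Budget Gr pre s l → Budget Gr′ (pre ++ [ x ]) s l
  budget-top {s = s} used (budget-start b) =
    budget-start (≤-trans (n≤1+n _) (subst (λ t → suc t ≤ g′ * s) used b))
  budget-top {Gr} {Gr′} {pre} {x} {s} used (budget-later m b) =
    budget-later m (subst (λ t → suc t ≤ g′ * s) moved b)
    where
    shift : ∀ a b c → suc a + b + c ≡ a + b + (c + 1)
    shift = solve-∀
    moved : Slack Gr + m * suc g + length pre ≡ Slack Gr′ + m * suc g + length (pre ++ [ x ])
    moved = trans (cong (λ t → t + m * suc g + length pre) used)
              (trans (shift (Slack Gr′) (m * suc g) (length pre))
                (cong (Slack Gr′ + m * suc g +_) (≡-sym (length-++ pre))))

  topPhase-top : ∀ {Gr j l x pre s} → Gr j ≢ [] → length (Gr j) < g →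
                 TopPhase Gr l pre s → TopPhase (update Gr j (Gr j ++ [ x ])) l (pre ++ [ x ]) s
  topPhase-top {Gr} {j} {x = x} nonempty room (top-phase s≤l occ small-or-budget) =
    top-phase s≤l (append-occupied Gr j x occ) (map₂ spend small-or-budget)
    where
    spend : ∀ {s l pre} → Σ (s < h) (λ s<h → Large s s<h × Budget Gr pre s l) →
            Σ (s < h) (λ s<h → Large s s<h × Budget (update Gr j (Gr j ++ [ x ])) (pre ++ [ x ]) s l)
    spend (s<h , large , b) = s<h , large , budget-top (≡-sym (slack-top Gr j x nonempty room)) b

  -- Moving on to the next set in the fill phase; a large set is followed
  -- only by large sets.
  fillPhase-next : ∀ {Gr l l<h pre} (l+1<h : suc l < h) → FillPhase Gr l l<h [] pre →
                   FillPhase Gr (suc l) l+1<h (set (suc l) l+1<h) []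
  fillPhase-next {Gr} {l} {l<h} {pre} l+1<h (fill-phase _ after used) =
    fill-phase (λ _ → after) (≤-trans after (*-monoʳ-≤ g′ (n≤1+n (suc l)))) (used′ used)
    where
    used′ : OneGroupPerSet Gr l l<h [] pre → OneGroupPerSet Gr (suc l) l+1<h (set (suc l) l+1<h) []
    used′ (set-unstarted _ occ≤l)  = set-unstarted refl (m≤n⇒m≤1+n occ≤l)
    used′ (set-done _ occ≤l+1)     = set-unstarted refl occ≤l+1
    used′ (set-large large)        = set-large (<-≤-trans large (set-sorted l<h l+1<h (n≤1+n l)))

  -- A finished set after s is large, so it used more than g free slots.
  budget-next : ∀ {Gr pre s l} (s<h : s < h) (l<h : l < h) → Large s s<h → s ≤ l →
                pre ≡ set l l<h → Budget Gr pre s l → Budget Gr [] s (suc l)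
  budget-next {s = s} _ _ _ _ _ (budget-start b) =
    budget-later 0 (subst (λ t → suc t ≤ g′ * s) (≡-sym (trans (+-identityʳ _) (+-identityʳ _))) b)
  budget-next {Gr} {pre} {s} s<h l<h large s≤l pre≡l (budget-later m b) =
    budget-later (suc m) (≤-trans (s≤s used) b)
    where
    open ≤-Reasoning
    reorder : ∀ a b c → a + (c + b) + 0 ≡ a + b + c
    reorder = solve-∀
    G≤pre : suc g ≤ length pre
    G≤pre = ≤-trans large (≤-trans (set-sorted s<h l<h s≤l) (≤-reflexive (cong length (≡-sym pre≡l))))
    used : Slack Gr + suc m * suc g + 0 ≤ Slack Gr + m * suc g + length pre
    used = begin
      Slack Gr + (suc g + m * suc g) + 0 ≡⟨ reorder (Slack Gr) (m * suc g) (suc g) ⟩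
      Slack Gr + m * suc g + suc g       ≤⟨ +-monoʳ-≤ (Slack Gr + m * suc g) G≤pre ⟩
      Slack Gr + m * suc g + length pre  ∎

  topPhase-next : ∀ {Gr l l<h pre s} → pre ≡ set l l<h → TopPhase Gr l pre s → TopPhase Gr (suc l) [] s
  topPhase-next {Gr} {l} {l<h} {pre} {s} pre≡l (top-phase s≤l occ small-or-budget) =
    top-phase (m≤n⇒m≤1+n s≤l) occ (map₂ finish small-or-budget)
    where
    finish : Σ (s < h) (λ s<h → Large s s<h × Budget Gr pre s l) →
             Σ (s < h) (λ s<h → Large s s<h × Budget Gr [] s (suc l))
    finish (s<h , large , b) = s<h , large , budget-next s<h l<h large s≤l pre≡l b

  budget-exhausted : ∀ {Gr pre s l} → Slack Gr ≡ 0 → Budget Gr pre s l → l ≤ s + s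
  budget-exhausted {s = s} _ (budget-start _) = m≤m+n s s
  budget-exhausted {Gr} {pre} {s} none (budget-later m b) = +-monoˡ-≤ s m<s
    where
    open ≤-Reasoning
    mG<sG : m * suc g < s * suc g
    mG<sG = begin-strict
      m * suc g                       ≤⟨ m≤m+n (m * suc g) (length pre) ⟩
      m * suc g + length pre          <⟨ subst (λ t → suc (t + m * suc g + length pre) ≤ g′ * s) none b ⟩
      g′ * s                          ≡⟨ *-comm g′ s ⟩
      s * g′                          ≤⟨ *-monoʳ-≤ s (≤-trans (n≤1+n g′) (n≤1+n g)) ⟩
      s * suc g                       ∎
    m<s : m < s
    m<s = *-cancelʳ-< (suc g) m s mG<sG

  -- Groups have owners, and s
  -- is h before the first top-up step and the set of that step afterwards.
  record Invariant (st : State n M) : Set where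
    constructor invariant
    field
      l          : ℕ
      l<h        : l < h
      cur pre    : List (Fin n)
      split      : pre ++ cur ≡ set l l<h
      queue      : proj₂ st ≡ cur ∷ drop (suc l) (tabulate N) ⊎ (proj₂ st ≡ [] × cur ≡ [])
      owner      : Fin M → ℕ
      s          : ℕ
      provenance : Provenance (proj₁ st) l owner s
      phase      : (s ≡ h × FillPhase (proj₁ st) l l<h cur pre) ⊎ TopPhase (proj₁ st) l pre s

  initial : (0<h : 0 < h) → Invariant (emptyGroups , tabulate N)
  initial 0<h =
    invariant 0 0<h (set 0 0<h) [] refl (inj₁ (drop-tabulate N 0 0<h)) (const 0) h (λ _ _ ())
      (inj₁ (refl , fill-phase (λ _ → no-slack) no-slack (set-unstarted refl (≤-reflexive empty-total))))
    where
    empty-total : sum {M} (λ _ → 0) ≡ 0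
    empty-total = sum-zeros {M} (λ _ → 0) (λ _ → refl)
    no-slack : ∀ {b} → Slack emptyGroups ≤ b
    no-slack = ≤-trans (≤-reflexive empty-total) z≤n

  step-invariant : ∀ {a b} → Invariant a → Step g M a b → Invariant b
  step-invariant (invariant _ _ _ _ _ (inj₂ (() , _)) _ _ _ _) (fill _ _)
  step-invariant (invariant _ _ _ _ _ (inj₂ (() , _)) _ _ _ _) (top _ _ _ _)
  step-invariant (invariant _ _ _ _ _ (inj₂ (() , _)) _ _ _ _) next
  step-invariant (invariant _ _ _ _ _ (inj₁ refl) _ _ _ (inj₂ ph)) (fill j empty) =
    ⊥-elim (TopPhase.all-occupied ph j empty)
  step-invariant (invariant l l<h (x ∷ xs) pre split (inj₁ refl) o s prov (inj₁ (s≡h , ph))) (fill j empty) =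
    invariant l l<h (drop g′ xs) (pre ++ chunk) split′ (inj₁ refl) (updateAt o j (const l)) s
      (provenance-fill l<h j chunk chunk⊆l prov) (inj₁ (s≡h , fillPhase-fill empty split ph))
    where
    chunk : List (Fin n)
    chunk = x ∷ take g′ xs
    split′ : (pre ++ chunk) ++ drop g′ xs ≡ set l l<h
    split′ = trans (++-assoc pre chunk (drop g′ xs))
               (trans (cong (λ ys → pre ++ x ∷ ys) (take++drop≡id g′ xs)) split)
    chunk⊆l : ∀ {y} → y ∈ₗ chunk → y ∈ₗ set l l<h
    chunk⊆l {y} y∈ = subst (y ∈ₗ_) split′ (∈-++⁺ˡ (∈-++⁺ʳ pre y∈))
  step-invariant (invariant l l<h (x ∷ xs) pre split (inj₁ refl) o s prov (inj₁ (s≡h , ph))) (top j occ nonempty room) =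
    invariant l l<h xs (pre ++ [ x ]) (trans (++-assoc pre [ x ] xs) split) (inj₁ refl) o l
      (provenance-top l<h j x (∈-split split) (<⇒≤ (subst (l <_) (≡-sym s≡h) l<h)) ≤-refl prov)
      (inj₂ (fillPhase-top occ nonempty room ph))
  step-invariant (invariant l l<h (x ∷ xs) pre split (inj₁ refl) o s prov (inj₂ ph)) (top j _ nonempty room) =
    invariant l l<h xs (pre ++ [ x ]) (trans (++-assoc pre [ x ] xs) split) (inj₁ refl) o s
      (provenance-top l<h j x (∈-split split) ≤-refl (TopPhase.s≤l ph) prov)
      (inj₂ (topPhase-top nonempty room ph))
  step-invariant {Gr , _} (invariant l l<h .[] pre split (inj₁ refl) o s prov ph) next with suc l <? h
  ... | no l+1≮h = invariant l l<h [] pre split (inj₂ (drop-tabulate-≥ N (suc l) (≮⇒≥ l+1≮h) , refl)) o s prov ph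
  ... | yes l+1<h =
    invariant (suc l) l+1<h (set (suc l) l+1<h) [] refl (inj₁ (drop-tabulate N (suc l) l+1<h)) o s
      (provenance-next prov) (phase-next ph)
    where
    phase-next : (s ≡ h × FillPhase Gr l l<h [] pre) ⊎ TopPhase Gr l pre s →
                 (s ≡ h × FillPhase Gr (suc l) l+1<h (set (suc l) l+1<h) []) ⊎ TopPhase Gr (suc l) [] s
    phase-next (inj₁ (s≡h , fill-ph)) = inj₁ (s≡h , fillPhase-next l+1<h fill-ph)
    phase-next (inj₂ top-ph) = inj₂ (topPhase-next {l<h = l<h} (trans (≡-sym (++-identityʳ pre)) split) top-ph)

  run-invariant : ∀ {a b} → Star (Step g M) a b → Invariant a → Invariant b
  run-invariant ε           inv = inv
  run-invariant (st ◅ run) inv = run-invariant run (step-invariant inv st)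

  Disjoint : Set
  Disjoint = ∀ l l′ → l ≢ l′ → ∀ x → x ∈ₗ N l → x ∈ₗ N l′ → Empty

  HitBy : Groups n M → Subset M → Set
  HitBy Gr R = ∀ l → ∃ λ x → x ∈ₗ N l × ∃ λ j → j ∈ R × x ∈ₗ Gr j

  -- A set hit by a removed group j is either owned by j or has index ≥ s;
  -- disjointness pins down the set a node comes from.
  hit-origin : ∀ {Gr l o s} → Provenance Gr l o s → Disjoint → ∀ {R} → HitBy Gr R →
               ∀ k → ∃ λ j → j ∈ R × toℕ k ≤ l × (toℕ k ≡ o j ⊎ s ≤ toℕ k)
  hit-origin prov disjoint hits k with hits k
  ... | x , x∈k , j , j∈R , x∈j with prov j x x∈j
  ...   | k′ , x∈k′ , k′≤l , origin with k ≟ᶠ k′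
  ...     | yes refl = j , j∈R , k′≤l , origin
  ...     | no k≢k′  = ⊥-elim (disjoint k k′ k≢k′ x x∈k x∈k′)

  -- The sets 0, ..., s-1 are hit through their owners, so s ≤ |R|.
  threshold≤∣R∣ : ∀ {Gr l o s} → Provenance Gr l o s → Disjoint → ∀ {R} → HitBy Gr R →
                  s ≤ h → s ≤ ∣ R ∣
  threshold≤∣R∣ {o = o} {s} prov disjoint {R} hits s≤h = owners-cover⇒≤∣R∣ o s R owned
    where
    owned : ∀ k → k < s → ∃ λ j → j ∈ R × o j ≡ k
    owned k k<s with hit-origin prov disjoint hits (fromℕ< (<-≤-trans k<s s≤h))
    ... | j , j∈R , _ , inj₁ k≡oj = j , j∈R , trans (≡-sym k≡oj) (toℕ-fromℕ< _)
    ... | _ , _   , _ , inj₂ s≤k  = ⊥-elim (<⇒≱ k<s (subst (s ≤_) (toℕ-fromℕ< _) s≤k))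

  -- The last set is hit, so the procedure has reached it.
  last-reached : ∀ {Gr l o s} → l < h → Provenance Gr l o s → Disjoint → ∀ {R} → HitBy Gr R →
                 h ∸ 1 ≤ l
  last-reached {l = l} l<h prov disjoint hits
    with hit-origin prov disjoint hits (fromℕ< (pred-< l<h))
  ... | _ , _ , k≤l , _ = subst (_≤ l) (toℕ-fromℕ< _) k≤l

  final-bound : ∀ {Gr rest} → Invariant (Gr , rest) → AllFull g Gr → Disjoint →
                (R : Subset M) → HitBy Gr R → ⌈ (h ∸ 1) /2⌉ ⊓ M ≤ ∣ R ∣
  final-bound {Gr} (invariant l l<h _ _ _ _ _ s prov phase) full disjoint R hits =
    [ fill-phase-bound ∘ proj₁ , top-phase-bound ]′ phase
    where
    s≤∣R∣ : s ≤ h → s ≤ ∣ R ∣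
    s≤∣R∣ = threshold≤∣R∣ prov disjoint hits
    -- no top-up step occurred: every set is hit through its owner
    fill-phase-bound : s ≡ h → ⌈ (h ∸ 1) /2⌉ ⊓ M ≤ ∣ R ∣
    fill-phase-bound s≡h = ≤-trans (m⊓n≤m _ M)
      (≤-trans (⌈n/2⌉≤n (h ∸ 1)) (≤-trans (m∸n≤m h 1) (subst (_≤ ∣ R ∣) s≡h (s≤∣R∣ (≤-reflexive s≡h)))))
    top-phase-bound : ∀ {pre} → TopPhase Gr l pre s → ⌈ (h ∸ 1) /2⌉ ⊓ M ≤ ∣ R ∣
    top-phase-bound (top-phase s≤l _ (inj₁ M≤s)) =
      ≤-trans (m⊓n≤n _ M) (≤-trans M≤s (s≤∣R∣ (<⇒≤ (≤-<-trans s≤l l<h))))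
    top-phase-bound (top-phase s≤l _ (inj₂ (_ , _ , budget))) =
      ≤-trans (m⊓n≤m _ M) (≤-trans (⌈/2⌉≤ h-1≤2s) (s≤∣R∣ (<⇒≤ (≤-<-trans s≤l l<h))))
      where
      h-1≤2s : h ∸ 1 ≤ s + s
      h-1≤2s = ≤-trans (last-reached l<h prov disjoint hits)
                       (budget-exhausted (all-full⇒Slack≡0 Gr full) budget)

lemma4 : ∀ {n : ℕ} (G : Graph n) (g : ℕ) ⦃ _ : NonZero g ⦄
         (h : ℕ) (N : Fin h → List (Fin n)) →
         (∀ l → Unique (N l)) →
         (∀ l → IsCDS G (λ x → x ∈ₗ N l)) →
         (∀ l l′ → l ≢ l′ → ∀ x → x ∈ₗ N l → x ∈ₗ N l′ → Empty) →
         (∀ x → ∃ λ l → x ∈ₗ N l) →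
         (∀ l l′ → toℕ l ≤ toℕ l′ → length (N l) ≤ length (N l′)) →
         (Gr : Fin (n / g) → List (Fin n)) →
         GroupOutcome g (n / g) N Gr →
         (R : Subset (n / g)) →
         (∀ l → ∃ λ x → x ∈ₗ N l × ∃ λ j → j ∈ R × x ∈ₗ Gr j) →
         ⌈ (h ∸ 1) /2⌉ ⊓ (n / g) ≤ ∣ R ∣
lemma4 _ zero ⦃ () ⦄ _ _ _ _ _ _ _ _ _ _ _
lemma4 _ (suc g′) zero _ _ _ _ _ _ _ _ _ _ = z≤n
lemma4 {n} _ (suc g′) (suc h′) N _ _ disjoint _ sorted Gr (_ , run , full) R hits =
  final-bound (run-invariant run (initial z<s)) full disjoint R hits
  where open GroupProcedure g′ (suc h′) N sorted (n / suc g′)
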